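{- Let $T^*_{\omega}$ be the group of trivial automorphisms of $\mathcal{P}(\mathbb{N})/\mathrm{fin}$. For every $f \in T^*_{\omega}$, the supremum in $\mathcal{P}(\mathbb{N})/\mathrm{fin}$ $$\mathrm{var}(f)=\sum\{a\in \mathcal{P}(\mathbb{N})/\mathrm{fin} \mid f(a)\cdot a=0\}$$ exists (i.e. it is an element of $\mathcal{P}(\mathbb{N})/\mathrm{fin}$).
   Context: $\mathcal{P}(\mathbb{N})/\mathrm{fin}$ is the Boolean algebra of subsets of $\mathbb{N}$ modulo the ideal of finite sets; $\cdot$ denotes Boolean meet and $\sum$ supremum. A trivial automorphism of $\mathcal{P}(\mathbb{N})/\mathrm{fin}$ is one induced by a bijection $\sigma: A\to B$ between cofinite subsets $A,B\subseteq\mathbb{N}$, via $[X]\mapsto[\sigma[X\cap A]]$; $T^*_{\omega}$ is the group of all such automorphisms. Note $\mathcal{P}(\mathbb{N})/\mathrm{fin}$ is not complete, so existence of the supremum is the content of the claim. -}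

module Defs where

open import Level using (0ℓ)
open import Data.Nat using (ℕ; _≤_)
open import Data.Product using (Σ; ∃; _×_)
open import Relation.Nullary using (¬_)
open import Relation.Unary using (Pred)
open import Relation.Binary.PropositionalEquality using (_≡_)

Subset : Set₁
Subset = Pred ℕ 0ℓ

Finite : Subset → Set
Finite X = Σ ℕ λ N → ∀ n → N ≤ n → ¬ X n

Cofinite : Subset → Set
Cofinite X = Finite (λ n → ¬ X n)

_∩_ : Subset → Subset → Subset
(X ∩ Y) n = X n × Y n

-- Order of P(ℕ)/fin on representatives: [X] ≤ [Y] iff X \ Y is finite.
_⊆*_ : Subset → Subset → Set
X ⊆* Y = Finite (λ n → X n × ¬ Y n)

-- [X] · [Y] = 0 in P(ℕ)/fin iff X ∩ Y is finite.
Disjoint* : Subset → Subset → Set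
Disjoint* X Y = Finite (X ∩ Y)

-- A trivial automorphism, given by a bijection σ : A → B between cofinite sets
-- (σ is represented by a function ℕ → ℕ whose values outside A are irrelevant).
record TrivialAut : Set₁ where
  field
    A B     : Subset
    cofinA  : Cofinite A
    cofinB  : Cofinite B
    σ       : ℕ → ℕ
    mapsTo  : ∀ n → A n → B (σ n)
    inj     : ∀ m n → A m → A n → σ m ≡ σ n → m ≡ n
    surj    : ∀ k → B k → ∃ λ n → A n × σ n ≡ k

  apply : Subset → Subset
  apply X k = ∃ λ n → A n × X n × σ n ≡ k

-- u (a representative) is the supremum in P(ℕ)/fin of the family S
-- (S is a property of representatives, invariant under =*).
IsSup : (Subset → Set) → Subset → Set₁
IsSup S u = (∀ a → S a → a ⊆* u)
          × (∀ b → (∀ a → S a → a ⊆* b) → u ⊆* b)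

VarFamily : TrivialAut → Subset → Set
VarFamily f a = Disjoint* (TrivialAut.apply f a) a

-- The supremum is the set of points moved by σ. If f(a)·a = 0 then almost
-- every point of a is moved, since a fixed point of σ in a lies in f(a) ∩ a.
-- Conversely, the graph joining n to σ n has degree at most 2, so colouring ℕ
-- greedily with three colours (each n has at most two earlier neighbours, σ n
-- and σ⁻¹ n) splits the moved points into three sets that σ moves off
-- themselves; each lies in the family, so every upper bound almost contains
-- their union. Excluded middle decides whether n has a σ-preimage.
module Submission where

open import Defs
open import Level using (0ℓ)
open import Axiom.ExcludedMiddle using (ExcludedMiddle)
open import Data.Nat using (ℕ; zero; suc; _≤_; _<_; _⊔_; _≟_; s≤s)
open import Data.Nat.Properties using (≤-trans; m≤m⊔n; m≤n⊔m; m⊔n≤o⇒m≤o; m⊔n≤o⇒n≤o; <-cmp; ≤∧≢⇒<)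
open import Data.Fin using (Fin; zero; suc)
open import Data.Product using (Σ; ∃; _×_; _,_; proj₁; proj₂)
open import Data.Empty using (⊥-elim)
open import Data.Sum using (_⊎_; inj₁; inj₂; [_,_])
open import Relation.Nullary using (¬_; yes; no)
open import Relation.Binary using (tri<; tri≈; tri>)
open import Relation.Binary.PropositionalEquality using (_≡_; _≢_; refl; sym; trans; cong; subst)

avoid : Fin 3 → Fin 3 → Fin 3
avoid zero             zero             = suc zero
avoid zero             (suc zero)       = suc (suc zero)
avoid zero             (suc (suc zero)) = suc zero
avoid (suc _)          (suc _)          = zero
avoid (suc zero)       zero             = suc (suc zero)
avoid (suc (suc zero)) zero             = suc zero

avoid-≢ˡ : ∀ a b → avoid a b ≢ a
avoid-≢ˡ zero             zero             ()
avoid-≢ˡ zero             (suc zero)       ()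
avoid-≢ˡ zero             (suc (suc zero)) ()
avoid-≢ˡ (suc _)          (suc _)          ()
avoid-≢ˡ (suc zero)       zero             ()
avoid-≢ˡ (suc (suc zero)) zero             ()

avoid-≢ʳ : ∀ a b → avoid a b ≢ b
avoid-≢ʳ zero             zero             ()
avoid-≢ʳ zero             (suc zero)       ()
avoid-≢ʳ zero             (suc (suc zero)) ()
avoid-≢ʳ (suc _)          (suc _)          ()
avoid-≢ʳ (suc zero)       zero             ()
avoid-≢ʳ (suc (suc zero)) zero             ()

-- Greedy colouring of ℕ in which n must differ from its neighbours c₁ n and
-- c₂ n whenever these come earlier; a later neighbour only contributes a junk
-- colour to the choice at n.
module GreedyColouring (c₁ c₂ : ℕ → ℕ) where

  extend : ℕ → (ℕ → Fin 3) → Fin 3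
  extend n h = avoid (h (c₁ n)) (h (c₂ n))

  colouringBelow : ℕ → ℕ → Fin 3
  colouringBelow zero    k = zero
  colouringBelow (suc n) k with k ≟ n
  ... | yes _ = extend n (colouringBelow n)
  ... | no  _ = colouringBelow n k

  colour : ℕ → Fin 3
  colour n = extend n (colouringBelow n)

  colouringBelow-stable : ∀ {k n} → k < n → colouringBelow n k ≡ colour k
  colouringBelow-stable {k} {suc n} (s≤s k≤n) with k ≟ n
  ... | yes refl = refl
  ... | no  k≢n  = colouringBelow-stable (≤∧≢⇒< k≤n k≢n)

  colour-≢₁ : ∀ {n} → c₁ n < n → colour n ≢ colour (c₁ n)
  colour-≢₁ c₁n<n eq =
    avoid-≢ˡ _ _ (trans eq (sym (colouringBelow-stable c₁n<n)))

  colour-≢₂ : ∀ {n} → c₂ n < n → colour n ≢ colour (c₂ n)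
  colour-≢₂ c₂n<n eq =
    avoid-≢ʳ _ _ (trans eq (sym (colouringBelow-stable c₂n<n)))

finite-⊆-∪ : {X Y Z : Subset} → Finite X → Finite Y →
             (∀ n → Z n → ¬ ¬ (X n ⊎ Y n)) → Finite Z
finite-⊆-∪ (M , X-fin) (N , Y-fin) Z⊆X∪Y =
  M ⊔ N , λ n M⊔N≤n Zn → Z⊆X∪Y n Zn
    [ X-fin n (m⊔n≤o⇒m≤o M N M⊔N≤n) , Y-fin n (m⊔n≤o⇒n≤o M N M⊔N≤n) ]

maxOver : ∀ {k} → (Fin k → ℕ) → ℕ
maxOver {zero}  g = zero
maxOver {suc k} g = g zero ⊔ maxOver (λ i → g (suc i))

≤-maxOver : ∀ {k} (g : Fin k → ℕ) i → g i ≤ maxOver g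
≤-maxOver g zero    = m≤m⊔n (g zero) _
≤-maxOver g (suc i) = ≤-trans (≤-maxOver (λ j → g (suc j)) i) (m≤n⊔m (g zero) _)

⊆*-⋃ : ∀ {k} {X b : Subset} (P : Fin k → Subset) → (∀ i → P i ⊆* b) →
       (∀ n → X n → ∃ λ i → P i n) → X ⊆* b
⊆*-⋃ {k} {X} {b} P P⊆*b X⊆⋃P = maxOver bound , beyond
  where
  bound : Fin k → ℕ
  bound i = proj₁ (P⊆*b i)
  beyond : ∀ n → maxOver bound ≤ n → ¬ (X n × ¬ b n)
  beyond n max≤n (Xn , ¬bn) with X⊆⋃P n Xn
  ... | i , Pᵢn = proj₂ (P⊆*b i) n (≤-trans (≤-maxOver bound i) max≤n) (Pᵢn , ¬bn)

module _ (f : TrivialAut) where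
  open TrivialAut f

  Moved : Subset
  Moved n = A n × σ n ≢ n

  VarFamily⇒⊆*Moved : ∀ a → VarFamily f a → a ⊆* Moved
  VarFamily⇒⊆*Moved a fa·a≡0 = finite-⊆-∪ cofinA fa·a≡0 outside-or-fixed
    where
    outside-or-fixed : ∀ n → a n × ¬ Moved n → ¬ ¬ (¬ A n ⊎ (apply a ∩ a) n)
    outside-or-fixed n (aₙ , unmoved) neither = neither (inj₁ λ Aₙ →
      unmoved (Aₙ , λ σn≡n → neither (inj₂ ((n , Aₙ , aₙ , σn≡n) , aₙ))))

module _ (lem : ExcludedMiddle 0ℓ) (f : TrivialAut) where
  open TrivialAut f

  preimage : ℕ → ℕ
  preimage k with lem {∃ λ n → A n × σ n ≡ k}
  ... | yes (n , _) = n
  ... | no  _       = k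

  preimage-σ : ∀ {n} → A n → preimage (σ n) ≡ n
  preimage-σ {n} Aₙ with lem {∃ λ m → A m × σ m ≡ σ n}
  ... | yes (m , Aₘ , σm≡σn) = inj m n Aₘ Aₙ σm≡σn
  ... | no  no-preimage      = ⊥-elim (no-preimage (n , Aₙ , refl))

  open GreedyColouring σ preimage

  colour-Moved-≢ : ∀ {n} → Moved f n → colour n ≢ colour (σ n)
  colour-Moved-≢ {n} (Aₙ , σn≢n) with <-cmp (σ n) n
  ... | tri< σn<n _ _ = colour-≢₁ σn<n
  ... | tri≈ _ σn≡n _ = ⊥-elim (σn≢n σn≡n)
  ... | tri> _ _ n<σn = λ eq →
    colour-≢₂ (subst (_< σ n) (sym (preimage-σ Aₙ)) n<σn)
              (trans (sym eq) (cong colour (sym (preimage-σ Aₙ))))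

  ColourClass : Fin 3 → Subset
  ColourClass i n = Moved f n × colour n ≡ i

  ColourClass-VarFamily : ∀ i → VarFamily f (ColourClass i)
  ColourClass-VarFamily i = zero , λ where
    _ _ ((n , _ , (movedₙ , colourₙ≡i) , refl) , (_ , colourσₙ≡i)) →
      colour-Moved-≢ movedₙ (trans colourₙ≡i (sym colourσₙ≡i))

  Moved-least : ∀ b → (∀ a → VarFamily f a → a ⊆* b) → Moved f ⊆* b
  Moved-least b isUpper =
    ⊆*-⋃ ColourClass (λ i → isUpper (ColourClass i) (ColourClass-VarFamily i))
         (λ n movedₙ → colour n , movedₙ , refl)

mainTheorem1 : ExcludedMiddle 0ℓ → (f : TrivialAut) →
    Σ Subset (λ u → IsSup (VarFamily f) u)
mainTheorem1 lem f = Moved f , VarFamily⇒⊆*Moved f , Moved-least lem f
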